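{- Let $n\ge1$ be a squarefree integer and for an integer $m$ let $$G(m):=|\{(d_1,d_2,d_3)\in\mathcal{D}_n^3:\ d_1+d_2=d_3+m\}|.$$ Then $G(m)\ll(3.969502)^{\omega(n)}$, uniformly in $m$ (with an absolute implied constant).
   Context: $\mathcal{D}_n$ is the set of positive divisors of $n$ and $\omega(n)$ the number of distinct prime factors of $n$. -}

module Defs where

open import Data.Nat using (ℕ; suc; _*_; _≤_)
open import Data.Nat.Divisibility using (_∣_; _∣?_)
open import Data.Nat.Primality using (Prime; prime?)
open import Data.Integer as ℤ using (ℤ; +_)
open import Data.List using (List; length; filter; upTo; cartesianProduct; drop)
open import Data.Product using (_×_; _,_)
open import Relation.Nullary using (¬_; Dec)
open import Relation.Nullary.Decidable using (_×-dec_)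
open import Relation.Binary.PropositionalEquality using (_≡_)

divisors : ℕ → List ℕ
divisors n = filter (λ d → d ∣? n) (drop 1 (upTo (suc n)))

ω : ℕ → ℕ
ω n = length (filter (λ p → prime? p ×-dec p ∣? n) (upTo (suc n)))

SquareFree : ℕ → Set
SquareFree n = ∀ p → Prime p → ¬ (p * p ∣ n)

Rel : ℤ → ℕ × (ℕ × ℕ) → Set
Rel m (d₁ , (d₂ , d₃)) = + d₁ ℤ.+ + d₂ ≡ + d₃ ℤ.+ m

Rel? : ∀ m (t : ℕ × (ℕ × ℕ)) → Dec (Rel m t)
Rel? m (d₁ , (d₂ , d₃)) = (+ d₁ ℤ.+ + d₂) ℤ.≟ (+ d₃ ℤ.+ m)

G : ℕ → ℤ → ℕ
G n m = length (filter (Rel? m) (cartesianProduct (divisors n) (cartesianProduct (divisors n) (divisors n))))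

-- Put k = d₃ + m. For a solution (d₁, d₂, d₃) and a prime p ∣ n, either p ∣ k, and then
-- p ∣ d₁ ⇔ p ∣ d₂, or p ∤ k, and then p divides at most one of d₁, d₂. A solution is
-- determined by d₃ together with any one of d₁, d₂, or (lcm(d₁,d₂), [d₁ ≤ d₂]): as n is
-- squarefree, gcd(d₁,d₂) = gcd(lcm(d₁,d₂), k), so the lcm and k determine the product d₁d₂.
-- Weight each of these codes by a product over the primes p ∣ n of 100 if p ∣ k, and
-- otherwise of 64 or 125 according as p does or does not divide d₁ (resp. d₂), and of 125
-- or 64 for the lcm. The three weights of a solution multiply to 100^(3ω(n)), so their sum
-- is at least 100^ω(n). Summed over all codes with a given d₃, a weight contributes 200 or
-- 64 + 125 = 189 per prime; since p ∣ d₃ + m forces p ∣ d₃ ⇔ p ∣ m, summing this over d₃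
-- gives at most (200 + 189)^ω(n). Hence G(m) · 100^ω(n) ≤ (1 + 1 + 2) · 389^ω(n).

module Submission where

open import Defs
open import Data.Bool using (Bool; true; false; T; _∨_)
open import Data.Integer as ℤ using (ℤ)
import Data.Integer.Divisibility.Signed as ℤ∣
open import Data.List using (List; []; _∷_; _++_; map; length; filter; upTo; drop; cartesianProduct)
open import Data.List.Properties using (map-++; map-∘; map-cong; ∷-injective)
open import Data.List.Membership.Propositional using (_∈_)
open import Data.List.Membership.Propositional.Properties
  using (∈-∃++; ∈-++⁺ˡ; ∈-++⁺ʳ; ∈-++⁻; ∈-map⁺; ∈-filter⁺; ∈-filter⁻; ∈-applyUpTo⁺;
         ∈-upTo⁺; ∈-cartesianProduct⁺; ∈-cartesianProduct⁻)
open import Data.List.Relation.Unary.All as All using (All; _∷_)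
open import Data.List.Relation.Unary.Any using (here; there)
open import Data.List.Relation.Unary.AllPairs using (_∷_)
open import Data.List.Relation.Unary.Unique.Propositional using (Unique)
import Data.List.Relation.Unary.Unique.Propositional.Properties as Unique
open import Data.Nat
  using (ℕ; zero; suc; _+_; _*_; _^_; _≤_; _∸_; _≤ᵇ_; _≤?_; s≤s; z≤n; NonZero; ≢-nonZero⁻¹)
open import Data.Nat.Properties
open import Algebra.Properties.CommutativeSemigroup +-commutativeSemigroup
  using (x∙yz≈y∙xz) renaming (interchange to +-interchange)
open import Algebra.Properties.CommutativeSemigroup *-commutativeSemigroup
  using () renaming (interchange to *-interchange)
open import Data.Nat.Divisibility
open import Data.Nat.GCD using (gcd; gcd[m,n]∣m; gcd[m,n]∣n; gcd-greatest)
open import Data.Nat.LCM using (lcm; m∣lcm[m,n]; n∣lcm[m,n]; lcm-least; gcd*lcm)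
open import Data.Nat.ListAction using (sum; product)
open import Data.Nat.ListAction.Properties using (sum-++)
open import Data.Nat.Primality using (Prime; prime?; prime[2]; euclidsLemma)
open import Data.Nat.Primality.Factorisation using (factorise; PrimeFactorisation)
open import Data.Nat.Tactic.RingSolver using (solve-∀)
open import Data.Product using (_×_; _,_; proj₁; proj₂; ∃; uncurry)
open import Data.Sum using (_⊎_; inj₁; inj₂; [_,_])
open import Function using (_∘_; _⇔_; mk⇔; Equivalence)
open import Relation.Binary.PropositionalEquality
  using (_≡_; refl; sym; trans; cong; cong₂; subst; module ≡-Reasoning)
open import Relation.Nullary using (does; yes; no; contradiction)
open import Relation.Nullary.Decidable using (_×-dec_; _⊎-dec_; dec-true; does-⇔)

private variable
  A B : Set

sum-map-+ : ∀ (f g : A → ℕ) xs → sum (map (λ x → f x + g x) xs) ≡ sum (map f xs) + sum (map g xs)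
sum-map-+ f g []       = refl
sum-map-+ f g (x ∷ xs) =
  trans (cong ((f x + g x) +_) (sum-map-+ f g xs)) (+-interchange (f x) (g x) _ _)

sum-map-*ˡ : ∀ c (f : A → ℕ) xs → sum (map (λ x → c * f x) xs) ≡ c * sum (map f xs)
sum-map-*ˡ c f []       = sym (*-zeroʳ c)
sum-map-*ˡ c f (x ∷ xs) =
  trans (cong (c * f x +_) (sum-map-*ˡ c f xs)) (sym (*-distribˡ-+ c (f x) _))

sum-map-const : ∀ c (xs : List A) → sum (map (λ _ → c) xs) ≡ length xs * c
sum-map-const c []       = refl
sum-map-const c (x ∷ xs) = cong (c +_) (sum-map-const c xs)

sum-map-mono-≤ : ∀ {f g : A → ℕ} xs → (∀ {x} → x ∈ xs → f x ≤ g x) →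
                 sum (map f xs) ≤ sum (map g xs)
sum-map-mono-≤ []       _   = ≤-refl
sum-map-mono-≤ (x ∷ xs) f≤g = +-mono-≤ (f≤g (here refl)) (sum-map-mono-≤ xs (f≤g ∘ there))

sum-map-cartesianProduct : ∀ (f : A × B → ℕ) xs ys →
  sum (map f (cartesianProduct xs ys)) ≡ sum (map (λ x → sum (map (λ y → f (x , y)) ys)) xs)
sum-map-cartesianProduct f []       ys = refl
sum-map-cartesianProduct f (x ∷ xs) ys = begin
  sum (map f (map (x ,_) ys ++ cartesianProduct xs ys))
    ≡⟨ cong sum (map-++ f (map (x ,_) ys) _) ⟩
  sum (map f (map (x ,_) ys) ++ map f (cartesianProduct xs ys))
    ≡⟨ sum-++ (map f (map (x ,_) ys)) _ ⟩
  sum (map f (map (x ,_) ys)) + sum (map f (cartesianProduct xs ys))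
    ≡⟨ cong₂ _+_ (cong sum (sym (map-∘ ys))) (sum-map-cartesianProduct f xs ys) ⟩
  sum (map (λ y → f (x , y)) ys) + sum (map (λ x → sum (map (λ y → f (x , y)) ys)) xs) ∎
  where open ≡-Reasoning

sum-map-++-∷ : ∀ (f : A → ℕ) us z vs → sum (map f (us ++ z ∷ vs)) ≡ f z + sum (map f (us ++ vs))
sum-map-++-∷ f []       z vs = refl
sum-map-++-∷ f (u ∷ us) z vs = trans (cong (f u +_) (sum-map-++-∷ f us z vs)) (x∙yz≈y∙xz (f u) (f z) _)

sum-map-∘-≤ : ∀ (F : B → ℕ) {c : A → B} {xs ys} → Unique xs →
  (∀ {x y} → x ∈ xs → y ∈ xs → c x ≡ c y → x ≡ y) → (∀ {x} → x ∈ xs → c x ∈ ys) →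
  sum (map (F ∘ c) xs) ≤ sum (map F ys)
sum-map-∘-≤ F {xs = []} _ _ _ = z≤n
sum-map-∘-≤ F {c} {x ∷ xs} (x∉xs ∷ xs-unique) c-injective c∈ys with ∈-∃++ (c∈ys (here refl))
... | us , vs , refl = begin
  F (c x) + sum (map (F ∘ c) xs)
    ≤⟨ +-monoʳ-≤ (F (c x))
         (sum-map-∘-≤ F xs-unique (λ x∈ y∈ → c-injective (there x∈) (there y∈)) c∈us++vs) ⟩
  F (c x) + sum (map F (us ++ vs))
    ≡⟨ sum-map-++-∷ F us (c x) vs ⟨
  sum (map F (us ++ c x ∷ vs)) ∎
  where
  open ≤-Reasoning
  c∈us++vs : ∀ {y} → y ∈ xs → c y ∈ us ++ vs
  c∈us++vs {y} y∈xs with ∈-++⁻ us (c∈ys (there y∈xs))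
  ... | inj₁ cy∈us         = ∈-++⁺ˡ cy∈us
  ... | inj₂ (here cy≡cx)  =
    contradiction (c-injective (here refl) (there y∈xs) (sym cy≡cx)) (All.lookup x∉xs y∈xs)
  ... | inj₂ (there cy∈vs) = ∈-++⁺ʳ us cy∈vs

product-map-* : ∀ (f g : A → ℕ) xs →
                product (map (λ x → f x * g x) xs) ≡ product (map f xs) * product (map g xs)
product-map-* f g []       = refl
product-map-* f g (x ∷ xs) =
  trans (cong ((f x * g x) *_) (product-map-* f g xs)) (*-interchange (f x) (g x) _ _)

product-map-const : ∀ {f : A → ℕ} {c} xs → (∀ {x} → x ∈ xs → f x ≡ c) →
                    product (map f xs) ≡ c ^ length xs
product-map-const []       _   = refl
product-map-const (x ∷ xs) f≡c = cong₂ _*_ (f≡c (here refl)) (product-map-const xs (f≡c ∘ there))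

product-map-mono-≤ : ∀ {f g : A → ℕ} xs → (∀ {x} → x ∈ xs → f x ≤ g x) →
                     product (map f xs) ≤ product (map g xs)
product-map-mono-≤ []       _   = ≤-refl
product-map-mono-≤ (x ∷ xs) f≤g = *-mono-≤ (f≤g (here refl)) (product-map-mono-≤ xs (f≤g ∘ there))

map-cong-local⁻ : ∀ {f g : A → B} {x} xs → map f xs ≡ map g xs → x ∈ xs → f x ≡ g x
map-cong-local⁻ (y ∷ ys) eq (here refl) = proj₁ (∷-injective eq)
map-cong-local⁻ (y ∷ ys) eq (there x∈) = map-cong-local⁻ ys (proj₂ (∷-injective eq)) x∈

-- The Boolean functions on xs, each listed as its graph.
assignments : List A → List (List (A × Bool))
assignments []       = [] ∷ []
assignments (x ∷ xs) = map ((x , true) ∷_) (assignments xs) ++ map ((x , false) ∷_) (assignments xs)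

graph∈assignments : ∀ (g : A → Bool) xs → map (λ x → x , g x) xs ∈ assignments xs
graph∈assignments g []       = here refl
graph∈assignments g (x ∷ xs) with g x
... | true  = ∈-++⁺ˡ (∈-map⁺ ((x , true) ∷_) (graph∈assignments g xs))
... | false = ∈-++⁺ʳ _ (∈-map⁺ ((x , false) ∷_) (graph∈assignments g xs))

sum-assignments : ∀ (f : A → Bool → ℕ) xs →
  sum (map (product ∘ map (uncurry f)) (assignments xs)) ≡ product (map (λ x → f x true + f x false) xs)
sum-assignments f []       = refl
sum-assignments {A = A} f (x ∷ xs) = begin
  sum (map w (map ((x , true) ∷_) as ++ map ((x , false) ∷_) as))
    ≡⟨ trans (cong sum (map-++ w (map ((x , true) ∷_) as) _)) (sum-++ (map w (map ((x , true) ∷_) as)) _) ⟩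
  sum (map w (map ((x , true) ∷_) as)) + sum (map w (map ((x , false) ∷_) as))
    ≡⟨ cong₂ _+_ (cong sum (sym (map-∘ as))) (cong sum (sym (map-∘ as))) ⟩
  sum (map (λ v → f x true * w v) as) + sum (map (λ v → f x false * w v) as)
    ≡⟨ cong₂ _+_ (sum-map-*ˡ (f x true) w as) (sum-map-*ˡ (f x false) w as) ⟩
  f x true * sum (map w as) + f x false * sum (map w as)
    ≡⟨ *-distribʳ-+ (sum (map w as)) (f x true) (f x false) ⟨
  (f x true + f x false) * sum (map w as)
    ≡⟨ cong ((f x true + f x false) *_) (sum-assignments f xs) ⟩
  (f x true + f x false) * product (map (λ x → f x true + f x false) xs) ∎
  where
  open ≡-Reasoning
  w : List (A × Bool) → ℕ
  w = product ∘ map (uncurry f)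
  as : List (List (A × Bool))
  as = assignments xs

^-distribʳ-* : ∀ k a b → (a * b) ^ k ≡ a ^ k * b ^ k
^-distribʳ-* zero    a b = refl
^-distribʳ-* (suc k) a b = trans (cong ((a * b) *_) (^-distribʳ-* k a b)) (*-interchange a b (a ^ k) (b ^ k))

cube≤product⇒≤sum : ∀ {l} a b c → l * l * l ≤ a * b * c → l ≤ a + b + c
cube≤product⇒≤sum {l} a b c l³≤abc with l ≤? a | l ≤? b | l ≤? c
... | yes l≤a | _       | _       = ≤-trans l≤a (≤-trans (m≤m+n a b) (m≤m+n (a + b) c))
... | no _    | yes l≤b | _       = ≤-trans l≤b (≤-trans (m≤n+m b a) (m≤m+n (a + b) c))
... | no _    | no _    | yes l≤c = ≤-trans l≤c (m≤n+m c (a + b))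
... | no l≰a  | no l≰b  | no l≰c  =
  contradiction l³≤abc (<⇒≱ (*-mono-< (*-mono-< (≰⇒> l≰a) (≰⇒> l≰b)) (≰⇒> l≰c)))

+-*-≤⇒≡⊎swap : ∀ {a b c d} → a ≤ c → a + b ≡ c + d → a * b ≡ c * d →
                a ≡ c ⊎ (a ≡ d × b ≡ c)
+-*-≤⇒≡⊎swap {a} {b} {c} {d} a≤c +≡ *≡ with c ∸ a | m+[n∸m]≡n a≤c
... | zero  | a+0≡c = inj₁ (trans (sym (+-identityʳ a)) a+0≡c)
... | suc t | refl  = inj₂ (a≡d , trans b≡s+d (trans (cong (s +_) (sym a≡d)) (+-comm s a)))
  where
  open ≡-Reasoning
  s : ℕ
  s = suc t
  b≡s+d : b ≡ s + d
  b≡s+d = +-cancelˡ-≡ a b (s + d) (trans +≡ (+-assoc a s d))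
  a≡d : a ≡ d
  a≡d = *-cancelˡ-≡ a d s (+-cancelʳ-≡ (a * d) (s * a) (s * d) (begin
    s * a + a * d   ≡⟨ cong (_+ a * d) (*-comm s a) ⟩
    a * s + a * d   ≡⟨ *-distribˡ-+ a s d ⟨
    a * (s + d)     ≡⟨ cong (a *_) b≡s+d ⟨
    a * b           ≡⟨ *≡ ⟩
    (a + s) * d     ≡⟨ *-distribʳ-+ d a s ⟩
    a * d + s * d   ≡⟨ +-comm (a * d) (s * d) ⟩
    s * d + a * d   ∎))

≤ᵇ-sym⇒≡ : ∀ a b → (a ≤ᵇ b) ≡ (b ≤ᵇ a) → a ≡ b
≤ᵇ-sym⇒≡ a b eq with ≤-total a b
... | inj₁ a≤b = ≤-antisym a≤b (≤ᵇ⇒≤ b a (subst T eq (≤⇒≤ᵇ a≤b)))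
... | inj₂ b≤a = ≤-antisym (≤ᵇ⇒≤ a b (subst T (sym eq) (≤⇒≤ᵇ b≤a))) b≤a

≤ᵇ-agree⇒≡ : ∀ {a b c d} → (a ≤ᵇ b) ≡ (c ≤ᵇ d) → a ≡ c ⊎ (a ≡ d × b ≡ c) → a ≡ c
≤ᵇ-agree⇒≡ _  (inj₁ a≡c)           = a≡c
≤ᵇ-agree⇒≡ eq (inj₂ (refl , refl)) = ≤ᵇ-sym⇒≡ _ _ eq

+-*-≤ᵇ-injective : ∀ {a b c d} → (a ≤ᵇ b) ≡ (c ≤ᵇ d) → a + b ≡ c + d → a * b ≡ c * d → a ≡ c
+-*-≤ᵇ-injective {a} {b} {c} {d} ≤ᵇ≡ +≡ *≡ with ≤-total a c
... | inj₁ a≤c = ≤ᵇ-agree⇒≡ ≤ᵇ≡ (+-*-≤⇒≡⊎swap a≤c +≡ *≡)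
... | inj₂ c≤a = sym (≤ᵇ-agree⇒≡ (sym ≤ᵇ≡) (+-*-≤⇒≡⊎swap c≤a (sym +≡) (sym *≡)))

squareFree⇒nonZero : ∀ {n} → SquareFree n → NonZero n
squareFree⇒nonZero {zero}  sqf = contradiction ((2 * 2) ∣0) (sqf 2 prime[2])
squareFree⇒nonZero {suc n} _   = _

∣-squareFree : ∀ {d n} → d ∣ n → SquareFree n → SquareFree d
∣-squareFree d∣n sqf p p-prime p²∣d = sqf p p-prime (∣-trans p²∣d d∣n)

squareFree⇒∣ : ∀ {d e} → SquareFree d → (∀ {p} → Prime p → p ∣ d → p ∣ e) → d ∣ e
squareFree⇒∣ {d} {e} sqf primes∣e =
  subst (_∣ e) (sym isFactorisation) (∏∣e factors factorsPrime (subst (_∣ d) isFactorisation ∣-refl))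
  where
  open PrimeFactorisation (factorise d {{squareFree⇒nonZero sqf}})
  ∏∣e : ∀ as → All Prime as → product as ∣ d → product as ∣ e
  ∏∣e []       _                    _      = 1∣ e
  ∏∣e (a ∷ as) (a-prime ∷ as-prime) a*as∣d with ∏∣e as as-prime (∣-trans (n∣m*n a) a*as∣d)
  ... | divides q e≡q*as = subst (a * product as ∣_) (sym e≡q*as) (*-monoˡ-∣ (product as) a∣q)
    where
    a∣q*as : a ∣ q * product as
    a∣q*as = subst (a ∣_) e≡q*as (primes∣e a-prime (∣-trans (m∣m*n (product as)) a*as∣d))
    a∣q : a ∣ q
    a∣q with euclidsLemma q (product as) a-prime a∣q*as
    ... | inj₁ a∣q  = a∣q
    ... | inj₂ a∣as = contradiction (∣-trans (*-monoʳ-∣ a a∣as) a*as∣d) (sqf a a-prime)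

prime∣lcm⇒∣⊎∣ : ∀ {p} a b → Prime p → p ∣ lcm a b → p ∣ a ⊎ p ∣ b
prime∣lcm⇒∣⊎∣ a b p-prime p∣lcm =
  euclidsLemma a b p-prime (∣-trans p∣lcm (lcm-least {a} {b} (m∣m*n b) (n∣m*n a)))

gcd≡gcd[lcm,+] : ∀ a b → SquareFree (lcm a b) → gcd a b ≡ gcd (lcm a b) (a + b)
gcd≡gcd[lcm,+] a b sqf = ∣-antisym
  (gcd-greatest (∣-trans (gcd[m,n]∣m a b) (m∣lcm[m,n] a b))
                (∣m∣n⇒∣m+n (gcd[m,n]∣m a b) (gcd[m,n]∣n a b)))
  (squareFree⇒∣ (∣-squareFree (gcd[m,n]∣m (lcm a b) (a + b)) sqf) prime∣gcd)
  where
  prime∣gcd : ∀ {p} → Prime p → p ∣ gcd (lcm a b) (a + b) → p ∣ gcd a b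
  prime∣gcd {p} p-prime p∣g =
    [ (λ p∣a → gcd-greatest p∣a (∣m+n∣m⇒∣n p∣a+b p∣a))
    , (λ p∣b → gcd-greatest (∣m+n∣m⇒∣n (subst (p ∣_) (+-comm a b) p∣a+b) p∣b) p∣b)
    ] (prime∣lcm⇒∣⊎∣ a b p-prime (∣-trans p∣g (gcd[m,n]∣m (lcm a b) (a + b))))
    where
    p∣a+b : p ∣ a + b
    p∣a+b = ∣-trans p∣g (gcd[m,n]∣n (lcm a b) (a + b))

*-determined-by-+-lcm : ∀ {a b c d} → SquareFree (lcm a b) →
                        a + b ≡ c + d → lcm a b ≡ lcm c d → a * b ≡ c * d
*-determined-by-+-lcm {a} {b} {c} {d} sqf +≡ lcm≡ = begin
  a * b                             ≡⟨ gcd*lcm a b ⟨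
  gcd a b * lcm a b                 ≡⟨ cong (_* lcm a b) (gcd≡gcd[lcm,+] a b sqf) ⟩
  gcd (lcm a b) (a + b) * lcm a b   ≡⟨ cong₂ (λ l s → gcd l s * l) lcm≡ +≡ ⟩
  gcd (lcm c d) (c + d) * lcm c d   ≡⟨ cong (_* lcm c d) (gcd≡gcd[lcm,+] c d (subst SquareFree lcm≡ sqf)) ⟨
  gcd c d * lcm c d                 ≡⟨ gcd*lcm c d ⟩
  c * d                             ∎
  where open ≡-Reasoning

+-≤ᵇ-lcm-injective : ∀ {a b c d} → SquareFree (lcm a b) →
  (a ≤ᵇ b) ≡ (c ≤ᵇ d) → a + b ≡ c + d → lcm a b ≡ lcm c d → a ≡ c × b ≡ d
+-≤ᵇ-lcm-injective {a} {b} {c} {d} sqf ≤ᵇ≡ +≡ lcm≡ =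
  a≡c , +-cancelˡ-≡ a b d (trans +≡ (cong (_+ d) (sym a≡c)))
  where
  a≡c : a ≡ c
  a≡c = +-*-≤ᵇ-injective ≤ᵇ≡ +≡ (*-determined-by-+-lcm {a} {b} {c} {d} sqf +≡ lcm≡)

infix 5 _∣ᵇ_
_∣ᵇ_ : ℕ → ℕ → Bool
p ∣ᵇ d = does (p ∣? d)

∣ᵇ-transport : ∀ {p a b} → p ∣ᵇ a ≡ p ∣ᵇ b → p ∣ a → p ∣ b
∣ᵇ-transport {p} {a} {b} eq p∣a with p ∣? b
... | yes p∣b = p∣b
... | no _    = contradiction (trans (sym (dec-true (p ∣? a) p∣a)) eq) λ ()

∣ᵇ-lcm : ∀ {p} a b → Prime p → p ∣ᵇ lcm a b ≡ (p ∣ᵇ a) ∨ (p ∣ᵇ b)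
∣ᵇ-lcm {p} a b p-prime = does-⇔
  (mk⇔ (prime∣lcm⇒∣⊎∣ a b p-prime)
       [ (λ p∣a → ∣-trans p∣a (m∣lcm[m,n] a b)) , (λ p∣b → ∣-trans p∣b (n∣lcm[m,n] a b)) ])
  (p ∣? lcm a b) (p ∣? a ⊎-dec p ∣? b)

∣+⇒[∣⇔∣] : ∀ {p d} m → p ∣ ℤ.∣ ℤ.+ d ℤ.+ m ∣ → p ∣ ℤ.∣ m ∣ ⇔ p ∣ d
∣+⇒[∣⇔∣] {p} {d} m p∣d+m = mk⇔
  (λ p∣m → ℤ∣.∣⇒∣ᵤ {ℤ.+ p} {ℤ.+ d}
             (ℤ∣.∣m+n∣n⇒∣m {ℤ.+ p} {ℤ.+ d} {m} (ℤ∣.∣ᵤ⇒∣ p∣d+m) (ℤ∣.∣ᵤ⇒∣ p∣m)))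
  (λ p∣d → ℤ∣.∣⇒∣ᵤ {ℤ.+ p} {m}
             (ℤ∣.∣m+n∣m⇒∣n {ℤ.+ p} {ℤ.+ d} {m} (ℤ∣.∣ᵤ⇒∣ p∣d+m) (ℤ∣.∣ᵤ⇒∣ p∣d)))

-- In divisorWeight and lcmWeight the first argument records p ∣ d₃ + m, the second whether
-- p divides the coded number.
divisorWeight : Bool → Bool → ℕ
divisorWeight true  _     = 100
divisorWeight false true  = 64
divisorWeight false false = 125

lcmWeight : Bool → Bool → ℕ
lcmWeight true  _     = 100
lcmWeight false true  = 125
lcmWeight false false = 64

marginalWeight : Bool → ℕ
marginalWeight true  = 200
marginalWeight false = 189

agreementWeight : Bool → Bool → ℕ
agreementWeight true  true  = 200
agreementWeight false false = 200
agreementWeight _     _     = 189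

divisorWeight-marginal : ∀ κ → divisorWeight κ true + divisorWeight κ false ≡ marginalWeight κ
divisorWeight-marginal true  = refl
divisorWeight-marginal false = refl

lcmWeight-marginal : ∀ κ → lcmWeight κ true + lcmWeight κ false ≡ marginalWeight κ
lcmWeight-marginal true  = refl
lcmWeight-marginal false = refl

agreementWeight-marginal : ∀ a → agreementWeight a true + agreementWeight a false ≡ 389
agreementWeight-marginal true  = refl
agreementWeight-marginal false = refl

weights-product : ∀ {p k} a b → Prime p → a + b ≡ k →
  divisorWeight (p ∣ᵇ k) (p ∣ᵇ a) * divisorWeight (p ∣ᵇ k) (p ∣ᵇ b) *
  lcmWeight (p ∣ᵇ k) (p ∣ᵇ lcm a b) ≡ 100 * 100 * 100
weights-product {p} a b p-prime refl rewrite ∣ᵇ-lcm a b p-prime with p ∣? a + b | p ∣? a | p ∣? b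
... | yes _    | _       | _       = refl
... | no p∤a+b | yes p∣a | yes p∣b = contradiction (∣m∣n⇒∣m+n p∣a p∣b) p∤a+b
... | no _     | yes _   | no _    = refl
... | no _     | no _    | yes _   = refl
... | no _     | no _    | no _    = refl

marginalWeight≤agreementWeight : ∀ {p} d m →
  marginalWeight (p ∣ᵇ ℤ.∣ ℤ.+ d ℤ.+ m ∣) ≤ agreementWeight (p ∣ᵇ ℤ.∣ m ∣) (p ∣ᵇ d)
marginalWeight≤agreementWeight {p} d m with p ∣? ℤ.∣ ℤ.+ d ℤ.+ m ∣ | p ∣? ℤ.∣ m ∣ | p ∣? d
... | yes _     | yes _   | yes _   = ≤-refl
... | yes _     | no _    | no _    = ≤-refl
... | yes p∣d+m | yes p∣m | no p∤d  = contradiction (Equivalence.to (∣+⇒[∣⇔∣] m p∣d+m) p∣m) p∤d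
... | yes p∣d+m | no p∤m  | yes p∣d = contradiction (Equivalence.from (∣+⇒[∣⇔∣] m p∣d+m) p∣d) p∤m
... | no _      | yes _   | yes _   = m≤m+n 189 11
... | no _      | no _    | no _    = m≤m+n 189 11
... | no _      | yes _   | no _    = ≤-refl
... | no _      | no _    | yes _   = ≤-refl

primeDivisors : ℕ → List ℕ
primeDivisors n = filter (λ p → prime? p ×-dec p ∣? n) (upTo (suc n))

module SquareFreeDivisors {n : ℕ} (sqf : SquareFree n) where

  private instance
    n≢0 : NonZero n
    n≢0 = squareFree⇒nonZero sqf

  P : List ℕ
  P = primeDivisors n

  D : List ℕ
  D = divisors n

  ∈-P⁺ : ∀ {p} → Prime p → p ∣ n → p ∈ P
  ∈-P⁺ p-prime p∣n =
    ∈-filter⁺ (λ p → prime? p ×-dec p ∣? n) (∈-upTo⁺ (s≤s (∣⇒≤ p∣n))) (p-prime , p∣n)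

  ∈-P⁻ : ∀ {p} → p ∈ P → Prime p
  ∈-P⁻ p∈P = proj₁ (proj₂ (∈-filter⁻ (λ p → prime? p ×-dec p ∣? n) {xs = upTo (suc n)} p∈P))

  ∈-D⁺ : ∀ {d} → d ∣ n → d ∈ D
  ∈-D⁺ {zero}  0∣n = contradiction (0∣⇒≡0 0∣n) (≢-nonZero⁻¹ n)
  ∈-D⁺ {suc d} d∣n = ∈-filter⁺ (_∣? n) (∈-applyUpTo⁺ suc (∣⇒≤ d∣n)) d∣n

  ∈-D⁻ : ∀ {d} → d ∈ D → d ∣ n
  ∈-D⁻ d∈D = proj₂ (∈-filter⁻ (_∣? n) {xs = drop 1 (upTo (suc n))} d∈D)

  D-unique : Unique D
  D-unique = Unique.filter⁺ (_∣? n) (Unique.drop⁺ 1 (Unique.upTo⁺ (suc n)))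

  signature : ℕ → List (ℕ × Bool)
  signature d = map (λ p → p , p ∣ᵇ d) P

  ∣-of-signature : ∀ {d e} → d ∣ n → signature d ≡ signature e → d ∣ e
  ∣-of-signature {d} d∣n sig≡ = squareFree⇒∣ (∣-squareFree d∣n sqf) λ p-prime p∣d →
    ∣ᵇ-transport (cong proj₂ (map-cong-local⁻ P sig≡ (∈-P⁺ p-prime (∣-trans p∣d d∣n)))) p∣d

  signature-injective : ∀ {d e} → d ∈ D → e ∈ D → signature d ≡ signature e → d ≡ e
  signature-injective d∈D e∈D sig≡ =
    ∣-antisym (∣-of-signature (∈-D⁻ d∈D) sig≡) (∣-of-signature (∈-D⁻ e∈D) (sym sig≡))

  sum-divisors≤product : ∀ (f : ℕ → Bool → ℕ) →
    sum (map (λ d → product (map (λ p → f p (p ∣ᵇ d)) P)) D) ≤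
    product (map (λ p → f p true + f p false) P)
  sum-divisors≤product f = begin
    sum (map (λ d → product (map (λ p → f p (p ∣ᵇ d)) P)) D)
      ≡⟨ cong sum (map-cong (λ d → cong product (map-∘ P)) D) ⟩
    sum (map (weight ∘ signature) D)
      ≤⟨ sum-map-∘-≤ weight D-unique signature-injective (λ _ → graph∈assignments _ P) ⟩
    sum (map weight (assignments P))
      ≡⟨ sum-assignments f P ⟩
    product (map (λ p → f p true + f p false) P) ∎
    where
    open ≤-Reasoning
    weight : List (ℕ × Bool) → ℕ
    weight = product ∘ map (uncurry f)

module Counting {n : ℕ} (sqf : SquareFree n) (m : ℤ) where
  open SquareFreeDivisors sqf

  D² : List (ℕ × ℕ)
  D² = cartesianProduct D D

  solutions : List (ℕ × ℕ × ℕ)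
  solutions = filter (Rel? m) (cartesianProduct D D²)

  -- On solutions d₃ + m = d₁ + d₂ ≥ 0, so taking the absolute value loses nothing.
  target : ℕ → ℕ
  target d₃ = ℤ.∣ ℤ.+ d₃ ℤ.+ m ∣

  ∈-solutions⁻ : ∀ {d₁ d₂ d₃} → (d₁ , d₂ , d₃) ∈ solutions →
                 d₁ ∈ D × d₂ ∈ D × d₃ ∈ D × d₁ + d₂ ≡ target d₃
  ∈-solutions⁻ s∈ =
    let s∈D³ , rel        = ∈-filter⁻ (Rel? m) {xs = cartesianProduct D D²} s∈
        d₁∈D , d₂d₃∈D²    = ∈-cartesianProduct⁻ D D² s∈D³
        d₂∈D , d₃∈D       = ∈-cartesianProduct⁻ D D d₂d₃∈D²
    in d₁∈D , d₂∈D , d₃∈D , cong ℤ.∣_∣ rel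

  solutions-unique : Unique solutions
  solutions-unique =
    Unique.filter⁺ (Rel? m) (Unique.cartesianProduct⁺ D-unique (Unique.cartesianProduct⁺ D-unique D-unique))

  codeWeight : (Bool → Bool → ℕ) → ℕ × ℕ → ℕ
  codeWeight φ (d₃ , d) = product (map (λ p → φ (p ∣ᵇ target d₃) (p ∣ᵇ d)) P)

  targetWeight : ℕ → ℕ
  targetWeight d₃ = product (map (λ p → marginalWeight (p ∣ᵇ target d₃)) P)

  sum-targetWeight≤ : sum (map targetWeight D) ≤ 389 ^ ω n
  sum-targetWeight≤ = begin
    sum (map targetWeight D)
      ≤⟨ sum-map-mono-≤ D (λ {d₃} _ →
           product-map-mono-≤ P (λ {p} _ → marginalWeight≤agreementWeight {p} d₃ m)) ⟩
    sum (map (λ d₃ → product (map (λ p → agreementWeight (p ∣ᵇ ℤ.∣ m ∣) (p ∣ᵇ d₃)) P)) D)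
      ≤⟨ sum-divisors≤product (λ p → agreementWeight (p ∣ᵇ ℤ.∣ m ∣)) ⟩
    product (map (λ p → agreementWeight (p ∣ᵇ ℤ.∣ m ∣) true + agreementWeight (p ∣ᵇ ℤ.∣ m ∣) false) P)
      ≡⟨ product-map-const P (λ {p} _ → agreementWeight-marginal (p ∣ᵇ ℤ.∣ m ∣)) ⟩
    389 ^ ω n ∎
    where open ≤-Reasoning

  sum-codeWeight≤ : ∀ φ → (∀ κ → φ κ true + φ κ false ≡ marginalWeight κ) →
    sum (map (codeWeight φ) D²) ≤ 389 ^ ω n
  sum-codeWeight≤ φ φ-marginal = begin
    sum (map (codeWeight φ) D²)
      ≡⟨ sum-map-cartesianProduct (codeWeight φ) D D ⟩
    sum (map (λ d₃ → sum (map (λ d → codeWeight φ (d₃ , d)) D)) D)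
      ≤⟨ sum-map-mono-≤ D (λ {d₃} _ → ≤-trans (sum-divisors≤product (λ p → φ (p ∣ᵇ target d₃)))
           (≤-reflexive (cong product (map-cong (λ p → φ-marginal (p ∣ᵇ target d₃)) P)))) ⟩
    sum (map targetWeight D)
      ≤⟨ sum-targetWeight≤ ⟩
    389 ^ ω n ∎
    where open ≤-Reasoning

  bools : List Bool
  bools = true ∷ false ∷ []

  ∈-bools : ∀ b → b ∈ bools
  ∈-bools true  = here refl
  ∈-bools false = there (here refl)

  lcmCodeWeight : Bool × ℕ × ℕ → ℕ
  lcmCodeWeight = codeWeight lcmWeight ∘ proj₂

  sum-lcmCodeWeight≤ : sum (map lcmCodeWeight (cartesianProduct bools D²)) ≤ 2 * 389 ^ ω n
  sum-lcmCodeWeight≤ = begin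
    sum (map lcmCodeWeight (cartesianProduct bools D²))
      ≡⟨ sum-map-cartesianProduct lcmCodeWeight bools D² ⟩
    sum (map (λ _ → sum (map (codeWeight lcmWeight) D²)) bools)
      ≡⟨ sum-map-const (sum (map (codeWeight lcmWeight) D²)) bools ⟩
    2 * sum (map (codeWeight lcmWeight) D²)
      ≤⟨ *-monoʳ-≤ 2 (sum-codeWeight≤ lcmWeight lcmWeight-marginal) ⟩
    2 * 389 ^ ω n ∎
    where open ≤-Reasoning

  code₁ : ℕ × ℕ × ℕ → ℕ × ℕ
  code₁ (d₁ , d₂ , d₃) = d₃ , d₁

  code₂ : ℕ × ℕ × ℕ → ℕ × ℕ
  code₂ (d₁ , d₂ , d₃) = d₃ , d₂

  lcmCode : ℕ × ℕ × ℕ → Bool × ℕ × ℕ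
  lcmCode (d₁ , d₂ , d₃) = (d₁ ≤ᵇ d₂) , d₃ , lcm d₁ d₂

  code₁-injective : ∀ {s t} → s ∈ solutions → t ∈ solutions → code₁ s ≡ code₁ t → s ≡ t
  code₁-injective {d₁ , d₂ , _} {_ , e₂ , _} s∈ t∈ refl
    with _ , _ , _ , +≡ ← ∈-solutions⁻ s∈ | _ , _ , _ , +≡′ ← ∈-solutions⁻ t∈
    with refl ← +-cancelˡ-≡ d₁ d₂ e₂ (trans +≡ (sym +≡′)) = refl

  code₂-injective : ∀ {s t} → s ∈ solutions → t ∈ solutions → code₂ s ≡ code₂ t → s ≡ t
  code₂-injective {d₁ , d₂ , _} {e₁ , _ , _} s∈ t∈ refl
    with _ , _ , _ , +≡ ← ∈-solutions⁻ s∈ | _ , _ , _ , +≡′ ← ∈-solutions⁻ t∈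
    with refl ← +-cancelʳ-≡ d₂ d₁ e₁ (trans +≡ (sym +≡′)) = refl

  lcmCode-injective : ∀ {s t} → s ∈ solutions → t ∈ solutions → lcmCode s ≡ lcmCode t → s ≡ t
  lcmCode-injective {d₁ , d₂ , _} {e₁ , e₂ , _} s∈ t∈ eq
    with d₁∈D , d₂∈D , _ , +≡ ← ∈-solutions⁻ s∈ | _ , _ , _ , +≡′ ← ∈-solutions⁻ t∈
    with refl ← cong (proj₁ ∘ proj₂) eq
    with refl , refl ← +-≤ᵇ-lcm-injective {d₁} {d₂} {e₁} {e₂}
                         (∣-squareFree (lcm-least (∈-D⁻ d₁∈D) (∈-D⁻ d₂∈D)) sqf)
                         (cong proj₁ eq) (trans +≡ (sym +≡′)) (cong (proj₂ ∘ proj₂) eq) = refl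

  code₁∈ : ∀ {s} → s ∈ solutions → code₁ s ∈ D²
  code₁∈ {_ , _ , _} s∈ with d₁∈D , _ , d₃∈D , _ ← ∈-solutions⁻ s∈ = ∈-cartesianProduct⁺ d₃∈D d₁∈D

  code₂∈ : ∀ {s} → s ∈ solutions → code₂ s ∈ D²
  code₂∈ {_ , _ , _} s∈ with _ , d₂∈D , d₃∈D , _ ← ∈-solutions⁻ s∈ = ∈-cartesianProduct⁺ d₃∈D d₂∈D

  lcmCode∈ : ∀ {s} → s ∈ solutions → lcmCode s ∈ cartesianProduct bools D²
  lcmCode∈ {_ , _ , _} s∈ with d₁∈D , d₂∈D , d₃∈D , _ ← ∈-solutions⁻ s∈ =
    ∈-cartesianProduct⁺ (∈-bools _) (∈-cartesianProduct⁺ d₃∈D (∈-D⁺ (lcm-least (∈-D⁻ d₁∈D) (∈-D⁻ d₂∈D))))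

  solutionWeight : ℕ × ℕ × ℕ → ℕ
  solutionWeight s =
    codeWeight divisorWeight (code₁ s) + codeWeight divisorWeight (code₂ s) + lcmCodeWeight (lcmCode s)

  100^ω≤solutionWeight : ∀ {s} → s ∈ solutions → 100 ^ ω n ≤ solutionWeight s
  100^ω≤solutionWeight {d₁ , d₂ , d₃} s∈ with _ , _ , _ , +≡ ← ∈-solutions⁻ s∈ =
    cube≤product⇒≤sum (product (map w₁ P)) (product (map w₂ P)) (product (map wₗ P)) (≤-reflexive (begin
    100 ^ ω n * 100 ^ ω n * 100 ^ ω n
      ≡⟨ trans (^-distribʳ-* (ω n) (100 * 100) 100) (cong (_* 100 ^ ω n) (^-distribʳ-* (ω n) 100 100)) ⟨
    (100 * 100 * 100) ^ ω n
      ≡⟨ product-map-const P (λ p∈P → weights-product d₁ d₂ (∈-P⁻ p∈P) +≡) ⟨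
    product (map (λ p → w₁ p * w₂ p * wₗ p) P)
      ≡⟨ trans (product-map-* (λ p → w₁ p * w₂ p) wₗ P)
               (cong (_* product (map wₗ P)) (product-map-* w₁ w₂ P)) ⟩
    product (map w₁ P) * product (map w₂ P) * product (map wₗ P) ∎))
    where
    open ≡-Reasoning
    w₁ w₂ wₗ : ℕ → ℕ
    w₁ p = divisorWeight (p ∣ᵇ target d₃) (p ∣ᵇ d₁)
    w₂ p = divisorWeight (p ∣ᵇ target d₃) (p ∣ᵇ d₂)
    wₗ p = lcmWeight (p ∣ᵇ target d₃) (p ∣ᵇ lcm d₁ d₂)

  length[solutions]*100^ω≤4*389^ω : length solutions * 100 ^ ω n ≤ 4 * 389 ^ ω n
  length[solutions]*100^ω≤4*389^ω = begin
    length solutions * 100 ^ ω n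
      ≡⟨ sum-map-const (100 ^ ω n) solutions ⟨
    sum (map (λ _ → 100 ^ ω n) solutions)
      ≤⟨ sum-map-mono-≤ solutions 100^ω≤solutionWeight ⟩
    sum (map solutionWeight solutions)
      ≡⟨ trans (sum-map-+ (λ s → w₁ s + w₂ s) wₗ solutions)
               (cong (_+ sum (map wₗ solutions)) (sum-map-+ w₁ w₂ solutions)) ⟩
    sum (map w₁ solutions) + sum (map w₂ solutions) + sum (map wₗ solutions)
      ≤⟨ +-mono-≤ (+-mono-≤ (sum-map-∘-≤ (codeWeight divisorWeight) solutions-unique code₁-injective code₁∈)
                            (sum-map-∘-≤ (codeWeight divisorWeight) solutions-unique code₂-injective code₂∈))
                  (sum-map-∘-≤ lcmCodeWeight solutions-unique lcmCode-injective lcmCode∈) ⟩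
    sum (map (codeWeight divisorWeight) D²) + sum (map (codeWeight divisorWeight) D²) +
    sum (map lcmCodeWeight (cartesianProduct bools D²))
      ≤⟨ +-mono-≤ (+-mono-≤ (sum-codeWeight≤ divisorWeight divisorWeight-marginal)
                            (sum-codeWeight≤ divisorWeight divisorWeight-marginal))
                  sum-lcmCodeWeight≤ ⟩
    389 ^ ω n + 389 ^ ω n + 2 * 389 ^ ω n
      ≡⟨ x+x+2x≡4x (389 ^ ω n) ⟩
    4 * 389 ^ ω n ∎
    where
    open ≤-Reasoning
    w₁ w₂ wₗ : ℕ × ℕ × ℕ → ℕ
    w₁ = codeWeight divisorWeight ∘ code₁
    w₂ = codeWeight divisorWeight ∘ code₂
    wₗ = lcmCodeWeight ∘ lcmCode
    x+x+2x≡4x : ∀ x → x + x + 2 * x ≡ 4 * x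
    x+x+2x≡4x = solve-∀

corollary3 : ∃ λ (C : ℕ) → ∀ (n : ℕ) → 1 ≤ n → SquareFree n → ∀ (m : ℤ) →
    G n m * 1000000 ^ ω n ≤ C * 3969502 ^ ω n
corollary3 = 4 , bound
  where
  bound : ∀ n → 1 ≤ n → SquareFree n → ∀ m → G n m * 1000000 ^ ω n ≤ 4 * 3969502 ^ ω n
  bound n _ sqf m = begin
    G n m * 1000000 ^ k             ≡⟨ cong (G n m *_) (^-distribʳ-* k 100 10000) ⟩
    G n m * (100 ^ k * 10000 ^ k)   ≡⟨ *-assoc (G n m) (100 ^ k) (10000 ^ k) ⟨
    G n m * 100 ^ k * 10000 ^ k     ≤⟨ *-monoˡ-≤ (10000 ^ k) length[solutions]*100^ω≤4*389^ω ⟩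
    4 * 389 ^ k * 10000 ^ k         ≡⟨ *-assoc 4 (389 ^ k) (10000 ^ k) ⟩
    4 * (389 ^ k * 10000 ^ k)       ≡⟨ cong (4 *_) (^-distribʳ-* k 389 10000) ⟨
    4 * 3890000 ^ k                 ≤⟨ *-monoʳ-≤ 4 (^-monoˡ-≤ k (m≤m+n 3890000 79502)) ⟩
    4 * 3969502 ^ k                 ∎
    where
    open ≤-Reasoning
    open Counting sqf m
    k : ℕ
    k = ω n
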